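{- For every $n\ge0$, there is a one-to-one correspondence between the set of chains in plane trees with $n$ edges and the set of doubly rooted plane trees with $n$ edges in which each vertex on the path from the root to the distinguished vertex, excluding the distinguished vertex itself, is colored with one of two colors.
   Context: A plane tree is a rooted tree with linearly ordered children. A chain in a plane tree is a nonempty set of vertices all lying on a single path from the root to a leaf. "Chains in plane trees with $n$ edges" means pairs $(T,Q)$ with $T$ a plane tree with $n$ edges and $Q$ a chain of $T$. A doubly rooted plane tree is a plane tree with a distinguished vertex (possibly the root). -}

module Defs where

open import Data.Nat using (ℕ; zero; suc; _+_)
open import Data.Bool using (Bool; T)
open import Data.Fin using (Fin; zero; suc)
open import Data.List using (List; []; _∷_; length; lookup)
open import Data.List.Relation.Unary.All using (All; []; _∷_)
open import Data.Vec using (Vec)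
open import Data.Product using (Σ; Σ-syntax; ∃; _×_)
open import Relation.Binary.PropositionalEquality using (_≡_)

data Tree : Set where
  node : List Tree → Tree

children : Tree → List Tree
children (node ts) = ts

mutual
  edges : Tree → ℕ
  edges (node ts) = edgesL ts

  edgesL : List Tree → ℕ
  edgesL []       = 0
  edgesL (t ∷ ts) = suc (edges t) + edgesL ts

data Vertex : Tree → Set where
  root  : ∀ {t} → Vertex t
  child : ∀ {ts} (i : Fin (length ts)) → Vertex (lookup ts i) → Vertex (node ts)

subtree : ∀ {t} → Vertex t → Tree
subtree {t} root = t
subtree (child i v) = subtree v

IsLeaf : ∀ {t} → Vertex t → Set
IsLeaf v = children (subtree v) ≡ []

data _≼_ : ∀ {t} → Vertex t → Vertex t → Set where
  root≼  : ∀ {t} {v : Vertex t} → root ≼ v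
  child≼ : ∀ {ts} (i : Fin (length ts)) {u v : Vertex (lookup ts i)} →
           u ≼ v → child {ts} i u ≼ child i v

depth : ∀ {t} → Vertex t → ℕ
depth root        = 0
depth (child i v) = suc (depth v)

-- A subset of the vertex set of a tree, as a Boolean marking of each vertex.
data Marking : Tree → Set where
  mk : ∀ {ts} → Bool → All Marking ts → Marking (node ts)

allLookup : ∀ {ts} → All Marking ts → (i : Fin (length ts)) → Marking (lookup ts i)
allLookup (m ∷ ms) zero    = m
allLookup (m ∷ ms) (suc i) = allLookup ms i

Marked : ∀ {t} → Marking t → Vertex t → Set
Marked (mk b ms) root        = T b
Marked (mk b ms) (child i v) = Marked (allLookup ms i) v

IsChain : ∀ {t} → Marking t → Set
IsChain {t} m =
  (∃ λ (v : Vertex t) → Marked m v) ×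
  (Σ[ ℓ ∈ Vertex t ] (IsLeaf ℓ × (∀ v → Marked m v → v ≼ ℓ)))

-- Chains of T; the chain property is an (irrelevant) property of the vertex set,
-- so two chains are equal iff they have the same vertex set.
record Chain (t : Tree) : Set where
  constructor chain
  field
    vertices : Marking t
    .isChain : IsChain vertices

ChainsInPlaneTrees : ℕ → Set
ChainsInPlaneTrees n = Σ[ T ∈ Tree ] (edges T ≡ n × Chain T)

-- Doubly rooted plane trees with n edges, together with a 2-colouring of the
-- vertices on the path from the root to the distinguished vertex v, excluding v
-- (these are depth v many vertices, listed from the root downwards; colours = Bool).
ColouredDoublyRooted : ℕ → Set
ColouredDoublyRooted n =
  Σ[ T ∈ Tree ] (edges T ≡ n × (Σ[ v ∈ Vertex T ] Vec Bool (depth v)))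

-- A chain lies on a root-to-leaf path, so it is determined by its deepest
-- vertex v together with the set of vertices strictly above v that it
-- contains; colouring each of those depth v vertices by whether it belongs to
-- the chain gives the coloured doubly rooted tree.  Conversely, v together with
-- the ancestors coloured true is a chain, because every vertex lies below some
-- leaf.
module Submission where

open import Defs
open import Data.Nat using (ℕ)
open import Data.Bool using (Bool; true; false; _∨_; if_then_else_)
open import Data.Bool.Properties using (∨-zeroʳ) renaming (_≟_ to _≟ᵇ_)
open import Data.Unit using (tt)
open import Data.Fin using (Fin; zero; suc)
open import Data.Fin.Properties using (suc-injective; 0≢1+n)
open import Data.List using (List; []; _∷_; length; lookup)
open import Data.List.Relation.Unary.All using (All; []; _∷_)
open import Data.Vec using (Vec; []; _∷_)
open import Data.Maybe using (Maybe; just; nothing; maybe′)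
import Data.Maybe as Maybe
open import Data.Product using (Σ-syntax; _×_; _,_; uncurry)
open import Data.Product.Function.Dependent.Propositional using (congˡ)
open import Data.Product.Function.NonDependent.Propositional using (_×-↔_)
open import Data.Empty using (⊥-elim)
open import Function using (_∘_)
open import Function.Bundles using (_↔_; mk↔ₛ′)
open import Function.Related.Propositional using (bijection)
open import Function.Properties.Inverse using (↔-refl)
open import Relation.Nullary using (Dec; yes; ¬_)
open import Relation.Nullary.Decidable using (map′; _×-dec_; recompute)
open import Relation.Binary.PropositionalEquality

private
  variable
    t : Tree
    ts : List Tree

mk-injective : ∀ {b b′} {ms ms′ : All Marking ts} → mk b ms ≡ mk b′ ms′ → b ≡ b′ × ms ≡ ms′
mk-injective refl = refl , refl

∷-injective : ∀ {m m′ : Marking t} {ms ms′ : All Marking ts} →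
              _≡_ {A = All Marking (t ∷ ts)} (m ∷ ms) (m′ ∷ ms′) → m ≡ m′ × ms ≡ ms′
∷-injective refl = refl , refl

mutual
  _≟_ : (m m′ : Marking t) → Dec (m ≡ m′)
  mk b ms ≟ mk b′ ms′ =
    map′ (λ { (refl , refl) → refl }) mk-injective (b ≟ᵇ b′ ×-dec ms ≟ₛ ms′)

  _≟ₛ_ : (ms ms′ : All Marking ts) → Dec (ms ≡ ms′)
  [] ≟ₛ [] = yes refl
  (m ∷ ms) ≟ₛ (m′ ∷ ms′) =
    map′ (λ { (refl , refl) → refl }) ∷-injective (m ≟ m′ ×-dec ms ≟ₛ ms′)

mutual
  ∅ : (t : Tree) → Marking t
  ∅ (node ts) = mk false (∅s ts)

  ∅s : (ts : List Tree) → All Marking ts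
  ∅s []       = []
  ∅s (t ∷ ts) = ∅ t ∷ ∅s ts

onlyAt : (ts : List Tree) (i : Fin (length ts)) → Marking (lookup ts i) → All Marking ts
onlyAt (t ∷ ts) zero    x = x ∷ ∅s ts
onlyAt (t ∷ ts) (suc i) x = ∅ t ∷ onlyAt ts i x

mutual
  ∅-unmarked : ∀ t w → ¬ Marked (∅ t) w
  ∅-unmarked (node ts) (child j w) = ∅s-unmarked ts j w

  ∅s-unmarked : ∀ ts j w → ¬ Marked (allLookup (∅s ts) j) w
  ∅s-unmarked (t ∷ ts) zero    = ∅-unmarked t
  ∅s-unmarked (t ∷ ts) (suc j) = ∅s-unmarked ts j

mutual
  unmarked⇒≡∅ : (m : Marking t) → (∀ w → ¬ Marked m w) → m ≡ ∅ t
  unmarked⇒≡∅ (mk true  ms) none = ⊥-elim (none root tt)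
  unmarked⇒≡∅ (mk false ms) none = cong (mk false) (unmarkeds⇒≡∅s ms λ j w → none (child j w))

  unmarkeds⇒≡∅s : (ms : All Marking ts) → (∀ j w → ¬ Marked (allLookup ms j) w) → ms ≡ ∅s ts
  unmarkeds⇒≡∅s []       none = refl
  unmarkeds⇒≡∅s (m ∷ ms) none =
    cong₂ _∷_ (unmarked⇒≡∅ m (none zero)) (unmarkeds⇒≡∅s ms λ j → none (suc j))

confined⇒≡onlyAt : (ms : All Marking ts) (i : Fin (length ts)) →
                   (∀ j w → Marked (allLookup ms j) w → j ≡ i) →
                   ms ≡ onlyAt ts i (allLookup ms i)
confined⇒≡onlyAt (m ∷ ms) zero confined =
  cong (m ∷_) (unmarkeds⇒≡∅s ms λ j w p → 0≢1+n (sym (confined (suc j) w p)))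
confined⇒≡onlyAt (m ∷ ms) (suc i) confined =
  cong₂ _∷_ (unmarked⇒≡∅ m λ w p → 0≢1+n (confined zero w p))
            (confined⇒≡onlyAt ms i λ j w p → suc-injective (confined (suc j) w p))

mutual
  hasMark : Marking t → Bool
  hasMark (mk b ms) = b ∨ hasMarks ms

  hasMarks : All Marking ts → Bool
  hasMarks []       = false
  hasMarks (m ∷ ms) = hasMark m ∨ hasMarks ms

mutual
  Marked⇒hasMark : (m : Marking t) (w : Vertex t) → Marked m w → hasMark m ≡ true
  Marked⇒hasMark (mk true ms)  root        _ = refl
  Marked⇒hasMark (mk b ms)     (child j w) p rewrite Marked⇒hasMarks ms j w p = ∨-zeroʳ b

  Marked⇒hasMarks : (ms : All Marking ts) (j : Fin (length ts)) (w : Vertex (lookup ts j)) →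
                    Marked (allLookup ms j) w → hasMarks ms ≡ true
  Marked⇒hasMarks (m ∷ ms) zero    w p rewrite Marked⇒hasMark m w p = refl
  Marked⇒hasMarks (m ∷ ms) (suc j) w p rewrite Marked⇒hasMarks ms j w p = ∨-zeroʳ (hasMark m)

mutual
  hasMark-∅ : (t : Tree) → hasMark (∅ t) ≡ false
  hasMark-∅ (node ts) = hasMarks-∅s ts

  hasMarks-∅s : (ts : List Tree) → hasMarks (∅s ts) ≡ false
  hasMarks-∅s []       = refl
  hasMarks-∅s (t ∷ ts) rewrite hasMark-∅ t = hasMarks-∅s ts

ColouredVertex : Tree → Set
ColouredVertex t = Σ[ v ∈ Vertex t ] Vec Bool (depth v)

pathMarking : (v : Vertex t) → Vec Bool (depth v) → Marking t
pathMarking {node ts} root        []       = mk true (∅s ts)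
pathMarking {node ts} (child i v) (c ∷ cs) = mk c (onlyAt ts i (pathMarking v cs))

OnPathTo : Marking t → Vertex t → Set
OnPathTo m ℓ = ∀ u → Marked m u → u ≼ ℓ

≼-trans : {u v w : Vertex t} → u ≼ v → v ≼ w → u ≼ w
≼-trans root≼         _              = root≼
≼-trans (child≼ i p) (child≼ .i q) = child≼ i (≼-trans p q)

leafBelow : (v : Vertex t) → Σ[ ℓ ∈ Vertex t ] IsLeaf ℓ × v ≼ ℓ
leafBelow {node []}      root        = root , refl , root≼
leafBelow {node (t ∷ _)} root        with leafBelow {t} root
... | ℓ , leaf , _ = child zero ℓ , leaf , root≼
leafBelow                (child i v) with leafBelow v
... | ℓ , leaf , v≼ℓ = child i ℓ , leaf , child≼ i v≼ℓ

onlyAt-self : ∀ ts i (x : Marking (lookup ts i)) w → Marked x w → Marked (allLookup (onlyAt ts i x) i) w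
onlyAt-self (t ∷ ts) zero    x w p = p
onlyAt-self (t ∷ ts) (suc i) x w p = onlyAt-self ts i x w p

onlyAt-onPath : ∀ ts i (x : Marking (lookup ts i)) {b v} →
                OnPathTo x v → OnPathTo (mk b (onlyAt ts i x)) (child i v)
onlyAt-onPath ts       i       x     x⊑v root              _ = root≼
onlyAt-onPath (t ∷ ts) zero    x     x⊑v (child zero w)    p = child≼ zero (x⊑v w p)
onlyAt-onPath (t ∷ ts) zero    x     x⊑v (child (suc j) w) p = ⊥-elim (∅s-unmarked ts j w p)
onlyAt-onPath (t ∷ ts) (suc i) x     x⊑v (child zero w)    p = ⊥-elim (∅-unmarked t w p)
onlyAt-onPath (t ∷ ts) (suc i) x {b} x⊑v (child (suc j) w) p
  with onlyAt-onPath ts i x {b} x⊑v (child j w) p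
... | child≼ .j w≼v = child≼ (suc j) w≼v

pathMarking-self : (v : Vertex t) (cs : Vec Bool (depth v)) → Marked (pathMarking v cs) v
pathMarking-self {node ts} root        []       = tt
pathMarking-self {node ts} (child i v) (c ∷ cs) = onlyAt-self ts i (pathMarking v cs) v (pathMarking-self v cs)

pathMarking-onPath : (v : Vertex t) (cs : Vec Bool (depth v)) → OnPathTo (pathMarking v cs) v
pathMarking-onPath {node ts} root        []       root        _ = root≼
pathMarking-onPath {node ts} root        []       (child j w) p = ⊥-elim (∅s-unmarked ts j w p)
pathMarking-onPath {node ts} (child i v) (c ∷ cs) =
  onlyAt-onPath ts i (pathMarking v cs) (pathMarking-onPath v cs)

pathMarking-isChain : (v : Vertex t) (cs : Vec Bool (depth v)) → IsChain (pathMarking v cs)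
pathMarking-isChain v cs with leafBelow v
... | ℓ , leaf , v≼ℓ =
  (v , pathMarking-self v cs) , ℓ , leaf , λ u p → ≼-trans (pathMarking-onPath v cs u p) v≼ℓ

-- Follows the first branch containing a mark; on a chain that branch is the
-- only one.  The empty marking is sent to the root.
mutual
  deepest : Marking t → ColouredVertex t
  deepest (mk b ms) = maybe′ (λ (i , v , cs) → child i v , b ∷ cs) (root , []) (firstMarked ms)

  firstMarked : All Marking ts → Maybe (Σ[ i ∈ Fin (length ts) ] ColouredVertex (lookup ts i))
  firstMarked []       = nothing
  firstMarked (m ∷ ms) =
    if hasMark m then just (zero , deepest m) else Maybe.map (λ (i , r) → suc i , r) (firstMarked ms)

firstMarked-∅s : (ts : List Tree) → firstMarked (∅s ts) ≡ nothing
firstMarked-∅s []       = refl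
firstMarked-∅s (t ∷ ts) rewrite hasMark-∅ t | firstMarked-∅s ts = refl

firstMarked-onlyAt : ∀ ts i (x : Marking (lookup ts i)) → hasMark x ≡ true →
                     firstMarked (onlyAt ts i x) ≡ just (i , deepest x)
firstMarked-onlyAt (t ∷ ts) zero    x nonempty rewrite nonempty = refl
firstMarked-onlyAt (t ∷ ts) (suc i) x nonempty
  rewrite hasMark-∅ t | firstMarked-onlyAt ts i x nonempty = refl

deepest-pathMarking : (v : Vertex t) (cs : Vec Bool (depth v)) → deepest (pathMarking v cs) ≡ (v , cs)
deepest-pathMarking {node ts} root        []       rewrite firstMarked-∅s ts = refl
deepest-pathMarking {node ts} (child i v) (c ∷ cs)
  rewrite firstMarked-onlyAt ts i (pathMarking v cs)
            (Marked⇒hasMark (pathMarking v cs) v (pathMarking-self v cs))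
        | deepest-pathMarking v cs = refl

onPath-root⁻ : ∀ {b} {ms : All Marking ts} → OnPathTo (mk b ms) root →
               ∀ j w → ¬ Marked (allLookup ms j) w
onPath-root⁻ m⊑root j w p with m⊑root (child j w) p
... | ()

onPath-child⁻ : ∀ {b} {ms : All Marking ts} {i ℓ} → OnPathTo (mk b ms) (child i ℓ) →
                OnPathTo (allLookup ms i) ℓ
onPath-child⁻ {i = i} m⊑ℓ u p with m⊑ℓ (child i u) p
... | child≼ _ u≼ℓ = u≼ℓ

onPath-child⇒confined : ∀ {b} {ms : All Marking ts} {i ℓ} → OnPathTo (mk b ms) (child i ℓ) →
                        ∀ j w → Marked (allLookup ms j) w → j ≡ i
onPath-child⇒confined m⊑ℓ j w p with m⊑ℓ (child j w) p
... | child≼ _ _ = refl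

pathMarking-deepest-root : ∀ b (ms : All Marking ts) → (∀ j w → ¬ Marked (allLookup ms j) w) →
                           hasMark (mk b ms) ≡ true → uncurry pathMarking (deepest (mk b ms)) ≡ mk b ms
pathMarking-deepest-root {ts} b ms none nonempty with unmarkeds⇒≡∅s ms none
pathMarking-deepest-root {ts} true  _ _ _        | refl rewrite firstMarked-∅s ts = refl
pathMarking-deepest-root {ts} false _ _ nonempty | refl
  with () ← trans (sym (hasMarks-∅s ts)) nonempty

pathMarking-deepest-onlyAt : ∀ b i (x : Marking (lookup ts i)) → hasMark x ≡ true →
  uncurry pathMarking (deepest (mk b (onlyAt ts i x))) ≡ mk b (onlyAt ts i (uncurry pathMarking (deepest x)))
pathMarking-deepest-onlyAt {ts} b i x nonempty rewrite firstMarked-onlyAt ts i x nonempty = refl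

pathMarking-deepest : (m : Marking t) (ℓ : Vertex t) → OnPathTo m ℓ → hasMark m ≡ true →
                      uncurry pathMarking (deepest m) ≡ m
pathMarking-deepest (mk b ms) root m⊑ℓ nonempty =
  pathMarking-deepest-root b ms (onPath-root⁻ m⊑ℓ) nonempty
pathMarking-deepest {node ts} (mk b ms) (child i ℓ) m⊑ℓ nonempty with hasMark (allLookup ms i) in subtreeMarked
... | true = begin
  uncurry pathMarking (deepest (mk b ms))
    ≡⟨ cong (λ ms′ → uncurry pathMarking (deepest (mk b ms′))) ms≡ ⟩
  uncurry pathMarking (deepest (mk b (onlyAt ts i x)))
    ≡⟨ pathMarking-deepest-onlyAt b i x subtreeMarked ⟩
  mk b (onlyAt ts i (uncurry pathMarking (deepest x)))
    ≡⟨ cong (mk b ∘ onlyAt ts i) (pathMarking-deepest x ℓ (onPath-child⁻ m⊑ℓ) subtreeMarked) ⟩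
  mk b (onlyAt ts i x)
    ≡⟨ cong (mk b) (sym ms≡) ⟩
  mk b ms ∎
  where
  open ≡-Reasoning
  x = allLookup ms i
  ms≡ : ms ≡ onlyAt ts i x
  ms≡ = confined⇒≡onlyAt ms i (onPath-child⇒confined m⊑ℓ)
... | false = pathMarking-deepest-root b ms unmarked nonempty
  where
  unmarked : ∀ j w → ¬ Marked (allLookup ms j) w
  unmarked j w p with onPath-child⇒confined m⊑ℓ j w p
  ... | refl with () ← trans (sym subtreeMarked) (Marked⇒hasMark (allLookup ms j) w p)

isChain⇒pathMarking-deepest : (m : Marking t) → IsChain m → uncurry pathMarking (deepest m) ≡ m
isChain⇒pathMarking-deepest m ((u , m∋u) , ℓ , _ , m⊑ℓ) =
  pathMarking-deepest m ℓ m⊑ℓ (Marked⇒hasMark m u m∋u)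

chain-cong : ∀ {m m′ : Marking t} .{p : IsChain m} .{q : IsChain m′} → m ≡ m′ → chain m p ≡ chain m′ q
chain-cong refl = refl

-- The chain property is irrelevant, so the equation it yields is recovered
-- through decidable equality of markings.
chain↔colouredVertex : Chain t ↔ ColouredVertex t
chain↔colouredVertex = mk↔ₛ′
  (deepest ∘ Chain.vertices)
  (λ (v , cs) → chain (pathMarking v cs) (pathMarking-isChain v cs))
  (λ (v , cs) → deepest-pathMarking v cs)
  (λ (chain m isChain) →
     chain-cong (recompute (uncurry pathMarking (deepest m) ≟ m) (isChain⇒pathMarking-deepest m isChain)))

theorem5p1 : (n : ℕ) → ChainsInPlaneTrees n ↔ ColouredDoublyRooted n
theorem5p1 n = congˡ {k = bijection} (↔-refl ×-↔ chain↔colouredVertex)
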